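{- Let $X_n = \frac{1}{2}\left((2+\sqrt{3})^n + (2-\sqrt{3})^n\right)$ for integers $n\ge 0$ (so that $(X_n,Y_n)$ with $Y_n=\frac{1}{2\sqrt3}((2+\sqrt3)^n-(2-\sqrt3)^n)$ are the nonnegative solutions of $X^2-3Y^2=1$). Then for every $n\ge 0$, \[ X_n \;=\; \binom{2n}{n} - \sum_{j\ge 1}(-1)^j\binom{2n}{n+2j} + 3\sum_{j\ge1}(-1)^j\binom{2n}{n+6j} \;=\; \binom{2n}{n} + \sum_{j \geq 1} \binom{2n}{n+2j}\, 2 \cos\frac{j \pi}{3}. \]
   Context: Binomial coefficients $\binom{m}{i}$ are taken to be $0$ for $i<0$ and for $i>m$, so the sums are finite. -}

module Defs where

open import Data.Nat as ℕ using (ℕ; zero; suc; _%_)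
open import Data.Nat.Combinatorics using (_C_)
open import Data.Integer using (ℤ; +_; -_; _+_; _*_; _-_)
open import Data.Product using (_×_; _,_; proj₁)

-- Elements a + b√3 of ℤ[√3], represented as pairs (a , b).
ℤ√3 : Set
ℤ√3 = ℤ × ℤ

_·_ : ℤ√3 → ℤ√3 → ℤ√3
(a , b) · (c , d) = (a * c + + 3 * (b * d) , a * d + b * c)

pow2+√3 : ℕ → ℤ√3
pow2+√3 zero    = (+ 1 , + 0)
pow2+√3 (suc n) = (+ 2 , + 1) · pow2+√3 n

-- If (2+√3)^n = a + b√3 then (2-√3)^n = a - b√3 (Galois conjugate),
-- so X_n = ½((2+√3)^n + (2-√3)^n) = a.
X : ℕ → ℤ
X n = proj₁ (pow2+√3 n)

Σ₁ : ℕ → (ℕ → ℤ) → ℤ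
Σ₁ zero    f = + 0
Σ₁ (suc m) f = Σ₁ m f + f (suc m)

sgn : ℕ → ℤ
sgn zero    = + 1
sgn (suc j) = - sgn j

binom : ℕ → ℕ → ℤ
binom m k = + (m C k)

twoCosPiThirdTable : ℕ → ℤ
twoCosPiThirdTable 0 = + 2
twoCosPiThirdTable 1 = + 1
twoCosPiThirdTable 2 = - + 1
twoCosPiThirdTable 3 = - + 2
twoCosPiThirdTable 4 = - + 1
twoCosPiThirdTable _ = + 1

twoCosPiThird : ℕ → ℤ
twoCosPiThird j = twoCosPiThirdTable (j % 6)

-- Read sequences on ℕ as even sequences on ℤ and pair them by summing over |k| ≤ N. The rows
-- k ↦ C(2n, n+k) satisfy row (n+1) = T (row n), where T is convolution with (1, 2, 1), and T is
-- self-adjoint for this pairing (a discrete Green identity), so pairing row n with w equals pairing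
-- row (n-1) with T w. The sequence k ↦ 2 cos(kπ/6) ∈ ℤ[√3] is an eigenvector of T with eigenvalue
-- 2 + 2 cos(π/6) = 2 + √3, so pairing it with row n gives 2 (2 + √3)ⁿ, whose rational part is 2 Xₙ.
-- The rational part of 2 cos(kπ/6) vanishes at odd k and is 2 cos(jπ/3) at k = 2j, which gives the
-- cosine form; the alternating form then follows from 2 cos(jπ/3) = −(−1)ʲ + 3 sgn₃ j, where
-- sgn₃ (3i) = (−1)ⁱ and sgn₃ vanishes off multiples of 3.
module Submission where

open import Defs
open import Data.Nat using (ℕ; _+_; _*_)
open import Data.Integer using (ℤ) renaming (_+_ to _+ℤ_; _-_ to _-ℤ_; _*_ to _*ℤ_)
open import Data.Integer using (+_)
open import Data.Product using (_×_)
open import Relation.Binary.PropositionalEquality using (_≡_)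

open import Data.Nat using (zero; suc; _≤_; _<_; _∸_; _%_; z≤n; s≤s)
import Data.Nat.Properties as ℕ
import Data.Nat.Tactic.RingSolver as ℕ-Solver
open import Data.Nat.Combinatorics using (_C_; nCk+nC[k+1]≡[n+1]C[k+1]; k>n⇒nCk≡0; nCk≡nC[n∸k])
open import Data.Nat.DivMod using ([m+n]%n≡m%n)
open import Data.Integer using (-_)
import Data.Integer.Properties as ℤ
open import Data.Integer.Tactic.RingSolver using (solve-∀)
open import Data.Product using (_,_; proj₁; proj₂)
open import Relation.Binary.PropositionalEquality
  using (refl; sym; trans; cong; cong₂; module ≡-Reasoning)

open ≡-Reasoning

Σ₁-cong : ∀ m {f g : ℕ → ℤ} → (∀ i → f i ≡ g i) → Σ₁ m f ≡ Σ₁ m g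
Σ₁-cong zero    eq = refl
Σ₁-cong (suc m) eq = cong₂ _+ℤ_ (Σ₁-cong m eq) (eq (suc m))

Σ₁-linear : ∀ m x y (f g : ℕ → ℤ) →
            Σ₁ m (λ i → x *ℤ f i +ℤ y *ℤ g i) ≡ x *ℤ Σ₁ m f +ℤ y *ℤ Σ₁ m g
Σ₁-linear zero    x y f g = sym (cong₂ _+ℤ_ (ℤ.*-zeroʳ x) (ℤ.*-zeroʳ y))
Σ₁-linear (suc m) x y f g =
  trans (cong (_+ℤ (x *ℤ f (suc m) +ℤ y *ℤ g (suc m))) (Σ₁-linear m x y f g))
        (regroup x y (Σ₁ m f) (Σ₁ m g) (f (suc m)) (g (suc m)))
  where
  regroup : ∀ x y F G p q →
            x *ℤ F +ℤ y *ℤ G +ℤ (x *ℤ p +ℤ y *ℤ q) ≡ x *ℤ (F +ℤ p) +ℤ y *ℤ (G +ℤ q)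
  regroup = solve-∀

Σ₁-+ : ∀ m r (f : ℕ → ℤ) → Σ₁ (m + r) f ≡ Σ₁ m f +ℤ Σ₁ r (λ i → f (m + i))
Σ₁-+ m zero    f = trans (cong (λ k → Σ₁ k f) (ℕ.+-identityʳ m)) (sym (ℤ.+-identityʳ _))
Σ₁-+ m (suc r) f = begin
  Σ₁ (m + suc r) f                                              ≡⟨ cong (λ k → Σ₁ k f) (ℕ.+-suc m r) ⟩
  Σ₁ (m + r) f +ℤ f (suc (m + r))                               ≡⟨ cong₂ _+ℤ_ (Σ₁-+ m r f) (cong f (sym (ℕ.+-suc m r))) ⟩
  Σ₁ m f +ℤ Σ₁ r (λ i → f (m + i)) +ℤ f (m + suc r)             ≡⟨ ℤ.+-assoc (Σ₁ m f) _ _ ⟩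
  Σ₁ m f +ℤ Σ₁ (suc r) (λ i → f (m + i))                        ∎

Σ₁-zero : ∀ r (f : ℕ → ℤ) → (∀ i → i < r → f (suc i) ≡ + 0) → Σ₁ r f ≡ + 0
Σ₁-zero zero    f z = refl
Σ₁-zero (suc r) f z = cong₂ _+ℤ_ (Σ₁-zero r f (λ i i<r → z i (ℕ.m<n⇒m<1+n i<r))) (z r (ℕ.n<1+n r))

Σ₁-truncate : ∀ {m N} (f : ℕ → ℤ) → m ≤ N → (∀ k → m < k → f k ≡ + 0) → Σ₁ N f ≡ Σ₁ m f
Σ₁-truncate {m} {N} f m≤N z = begin
  Σ₁ N f                                    ≡⟨ cong (λ k → Σ₁ k f) (sym (ℕ.m+[n∸m]≡n m≤N)) ⟩
  Σ₁ (m + (N ∸ m)) f                        ≡⟨ Σ₁-+ m (N ∸ m) f ⟩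
  Σ₁ m f +ℤ Σ₁ (N ∸ m) (λ i → f (m + i))    ≡⟨ cong (Σ₁ m f +ℤ_) (Σ₁-zero (N ∸ m) _ (λ i _ → z (m + suc i) (m<m+1+i i))) ⟩
  Σ₁ m f +ℤ + 0                             ≡⟨ ℤ.+-identityʳ (Σ₁ m f) ⟩
  Σ₁ m f                                    ∎
  where
  m<m+1+i : ∀ i → m < m + suc i
  m<m+1+i i = ℕ.m<m+n m (s≤s z≤n)

Σ₁-multiples : ∀ d m (f : ℕ → ℤ) → (∀ j i → i < d → f (j * suc d + suc i) ≡ + 0) →
               Σ₁ (m * suc d) f ≡ Σ₁ m (λ j → f (j * suc d))
Σ₁-multiples d zero    f z = refl
Σ₁-multiples d (suc m) f z = begin
  Σ₁ (suc d + M) f                                   ≡⟨ cong (λ k → Σ₁ k f) (ℕ.+-comm (suc d) M) ⟩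
  Σ₁ (M + suc d) f                                   ≡⟨ Σ₁-+ M (suc d) f ⟩
  Σ₁ M f +ℤ (Σ₁ d (λ i → f (M + i)) +ℤ f (M + suc d)) ≡⟨ cong (λ s → Σ₁ M f +ℤ (s +ℤ f (M + suc d))) (Σ₁-zero d _ (z m)) ⟩
  Σ₁ M f +ℤ (+ 0 +ℤ f (M + suc d))                   ≡⟨ cong₂ _+ℤ_ (Σ₁-multiples d m f z) (trans (ℤ.+-identityˡ _) (cong f (ℕ.+-comm M (suc d)))) ⟩
  Σ₁ m (λ j → f (j * suc d)) +ℤ f (suc m * suc d)    ∎
  where M = m * suc d

-- Convolution with (1, 2, 1) of the even extension of w, i.e. with w (-1) = w 1.
pascalStep : (ℕ → ℤ) → ℕ → ℤ
pascalStep w zero    = w 1 +ℤ + 2 *ℤ w 0 +ℤ w 1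
pascalStep w (suc k) = w k +ℤ + 2 *ℤ w (suc k) +ℤ w (suc (suc k))

-- pairing N α w = Σ_{|k| ≤ N} α |k| · w |k|.
pairing : ℕ → (ℕ → ℤ) → (ℕ → ℤ) → ℤ
pairing N α w = α 0 *ℤ w 0 +ℤ + 2 *ℤ Σ₁ N (λ k → α k *ℤ w k)

pairing-cong : ∀ N {α α′ w w′ : ℕ → ℤ} → (∀ k → α k ≡ α′ k) → (∀ k → w k ≡ w′ k) →
               pairing N α w ≡ pairing N α′ w′
pairing-cong N eqα eqw =
  cong₂ _+ℤ_ (cong₂ _*ℤ_ (eqα 0) (eqw 0))
             (cong (+ 2 *ℤ_) (Σ₁-cong N (λ k → cong₂ _*ℤ_ (eqα k) (eqw k))))

pairing-suc : ∀ N α w → pairing (suc N) α w ≡ pairing N α w +ℤ + 2 *ℤ (α (suc N) *ℤ w (suc N))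
pairing-suc N α w = regroup (α 0 *ℤ w 0) (Σ₁ N (λ k → α k *ℤ w k)) (α (suc N) *ℤ w (suc N))
  where
  regroup : ∀ x S t → x +ℤ + 2 *ℤ (S +ℤ t) ≡ x +ℤ + 2 *ℤ S +ℤ + 2 *ℤ t
  regroup = solve-∀

pairing-linear : ∀ N α x y (f g : ℕ → ℤ) →
                 pairing N α (λ k → x *ℤ f k +ℤ y *ℤ g k) ≡ x *ℤ pairing N α f +ℤ y *ℤ pairing N α g
pairing-linear N α x y f g = begin
  α 0 *ℤ (x *ℤ f 0 +ℤ y *ℤ g 0) +ℤ + 2 *ℤ Σ₁ N (λ k → α k *ℤ (x *ℤ f k +ℤ y *ℤ g k))
    ≡⟨ cong (λ s → α 0 *ℤ (x *ℤ f 0 +ℤ y *ℤ g 0) +ℤ + 2 *ℤ s)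
            (trans (Σ₁-cong N (λ k → distrib (α k) x y (f k) (g k))) (Σ₁-linear N x y _ _)) ⟩
  α 0 *ℤ (x *ℤ f 0 +ℤ y *ℤ g 0) +ℤ + 2 *ℤ (x *ℤ Σ₁ N (λ k → α k *ℤ f k) +ℤ y *ℤ Σ₁ N (λ k → α k *ℤ g k))
    ≡⟨ regroup (α 0) x y (f 0) (g 0) _ _ ⟩
  x *ℤ pairing N α f +ℤ y *ℤ pairing N α g ∎
  where
  distrib : ∀ a x y p q → a *ℤ (x *ℤ p +ℤ y *ℤ q) ≡ x *ℤ (a *ℤ p) +ℤ y *ℤ (a *ℤ q)
  distrib = solve-∀
  regroup : ∀ a x y p q F G → a *ℤ (x *ℤ p +ℤ y *ℤ q) +ℤ + 2 *ℤ (x *ℤ F +ℤ y *ℤ G)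
                            ≡ x *ℤ (a *ℤ p +ℤ + 2 *ℤ F) +ℤ y *ℤ (a *ℤ q +ℤ + 2 *ℤ G)
  regroup = solve-∀

pascalStep-green : ∀ N α w → pairing N (pascalStep α) w +ℤ + 2 *ℤ (α N *ℤ w (suc N))
                           ≡ pairing N α (pascalStep w) +ℤ + 2 *ℤ (α (suc N) *ℤ w N)
pascalStep-green zero    α w = base (α 0) (α 1) (w 0) (w 1)
  where
  base : ∀ a₀ a₁ w₀ w₁ → (a₁ +ℤ + 2 *ℤ a₀ +ℤ a₁) *ℤ w₀ +ℤ + 0 +ℤ + 2 *ℤ (a₀ *ℤ w₁)
                       ≡ a₀ *ℤ (w₁ +ℤ + 2 *ℤ w₀ +ℤ w₁) +ℤ + 0 +ℤ + 2 *ℤ (a₁ *ℤ w₀)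
  base = solve-∀
pascalStep-green (suc N) α w = begin
  pairing (suc N) (pascalStep α) w +ℤ + 2 *ℤ (a₁ *ℤ w₂)
    ≡⟨ cong (_+ℤ + 2 *ℤ (a₁ *ℤ w₂)) (pairing-suc N (pascalStep α) w) ⟩
  pairing N (pascalStep α) w +ℤ + 2 *ℤ ((a₀ +ℤ + 2 *ℤ a₁ +ℤ a₂) *ℤ w₁) +ℤ + 2 *ℤ (a₁ *ℤ w₂)
    ≡⟨ moveBoundary (pairing N (pascalStep α) w) (pairing N α (pascalStep w)) (pascalStep-green N α w) ⟩
  pairing N α (pascalStep w) +ℤ + 2 *ℤ (a₁ *ℤ (w₀ +ℤ + 2 *ℤ w₁ +ℤ w₂)) +ℤ + 2 *ℤ (a₂ *ℤ w₁)
    ≡⟨ cong (_+ℤ + 2 *ℤ (a₂ *ℤ w₁)) (sym (pairing-suc N α (pascalStep w))) ⟩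
  pairing (suc N) α (pascalStep w) +ℤ + 2 *ℤ (a₂ *ℤ w₁) ∎
  where
  a₀ = α N
  a₁ = α (suc N)
  a₂ = α (suc (suc N))
  w₀ = w N
  w₁ = w (suc N)
  w₂ = w (suc (suc N))
  moveBoundary : ∀ L R → L +ℤ + 2 *ℤ (a₀ *ℤ w₁) ≡ R +ℤ + 2 *ℤ (a₁ *ℤ w₀) →
         L +ℤ + 2 *ℤ ((a₀ +ℤ + 2 *ℤ a₁ +ℤ a₂) *ℤ w₁) +ℤ + 2 *ℤ (a₁ *ℤ w₂)
         ≡ R +ℤ + 2 *ℤ (a₁ *ℤ (w₀ +ℤ + 2 *ℤ w₁ +ℤ w₂)) +ℤ + 2 *ℤ (a₂ *ℤ w₁)
  moveBoundary L R eq = begin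
    L +ℤ + 2 *ℤ ((a₀ +ℤ + 2 *ℤ a₁ +ℤ a₂) *ℤ w₁) +ℤ + 2 *ℤ (a₁ *ℤ w₂)
      ≡⟨ split L a₀ a₁ a₂ w₁ w₂ ⟩
    L +ℤ + 2 *ℤ (a₀ *ℤ w₁) +ℤ + 2 *ℤ (+ 2 *ℤ a₁ *ℤ w₁ +ℤ a₂ *ℤ w₁ +ℤ a₁ *ℤ w₂)
      ≡⟨ cong (_+ℤ + 2 *ℤ (+ 2 *ℤ a₁ *ℤ w₁ +ℤ a₂ *ℤ w₁ +ℤ a₁ *ℤ w₂)) eq ⟩
    R +ℤ + 2 *ℤ (a₁ *ℤ w₀) +ℤ + 2 *ℤ (+ 2 *ℤ a₁ *ℤ w₁ +ℤ a₂ *ℤ w₁ +ℤ a₁ *ℤ w₂)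
      ≡⟨ merge R a₁ a₂ w₀ w₁ w₂ ⟩
    R +ℤ + 2 *ℤ (a₁ *ℤ (w₀ +ℤ + 2 *ℤ w₁ +ℤ w₂)) +ℤ + 2 *ℤ (a₂ *ℤ w₁) ∎
    where
    split : ∀ L a₀ a₁ a₂ w₁ w₂ →
            L +ℤ + 2 *ℤ ((a₀ +ℤ + 2 *ℤ a₁ +ℤ a₂) *ℤ w₁) +ℤ + 2 *ℤ (a₁ *ℤ w₂)
            ≡ L +ℤ + 2 *ℤ (a₀ *ℤ w₁) +ℤ + 2 *ℤ (+ 2 *ℤ a₁ *ℤ w₁ +ℤ a₂ *ℤ w₁ +ℤ a₁ *ℤ w₂)
    split = solve-∀
    merge : ∀ R a₁ a₂ w₀ w₁ w₂ →
            R +ℤ + 2 *ℤ (a₁ *ℤ w₀) +ℤ + 2 *ℤ (+ 2 *ℤ a₁ *ℤ w₁ +ℤ a₂ *ℤ w₁ +ℤ a₁ *ℤ w₂)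
            ≡ R +ℤ + 2 *ℤ (a₁ *ℤ (w₀ +ℤ + 2 *ℤ w₁ +ℤ w₂)) +ℤ + 2 *ℤ (a₂ *ℤ w₁)
    merge = solve-∀

pascalStep-selfAdjoint : ∀ N α w → α N ≡ + 0 → α (suc N) ≡ + 0 →
                         pairing N (pascalStep α) w ≡ pairing N α (pascalStep w)
pascalStep-selfAdjoint N α w αN≡0 αN+1≡0 = begin
  pairing N (pascalStep α) w                                     ≡⟨ sym (ℤ.+-identityʳ _) ⟩
  pairing N (pascalStep α) w +ℤ + 2 *ℤ (+ 0 *ℤ w (suc N))         ≡⟨ cong (λ a → pairing N (pascalStep α) w +ℤ + 2 *ℤ (a *ℤ w (suc N))) (sym αN≡0) ⟩
  pairing N (pascalStep α) w +ℤ + 2 *ℤ (α N *ℤ w (suc N))         ≡⟨ pascalStep-green N α w ⟩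
  pairing N α (pascalStep w) +ℤ + 2 *ℤ (α (suc N) *ℤ w N)         ≡⟨ cong (λ a → pairing N α (pascalStep w) +ℤ + 2 *ℤ (a *ℤ w N)) αN+1≡0 ⟩
  pairing N α (pascalStep w) +ℤ + 2 *ℤ (+ 0 *ℤ w N)               ≡⟨ ℤ.+-identityʳ _ ⟩
  pairing N α (pascalStep w)                                     ∎

binom-suc : ∀ m k → binom (suc m) (suc k) ≡ binom m k +ℤ binom m (suc k)
binom-suc m k = trans (cong +_ (sym (nCk+nC[k+1]≡[n+1]C[k+1] m k))) (ℤ.pos-+ (m C k) (m C suc k))

binom-pascal² : ∀ m k → binom (2 + m) (2 + k) ≡ binom m k +ℤ + 2 *ℤ binom m (1 + k) +ℤ binom m (2 + k)
binom-pascal² m k = begin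
  binom (2 + m) (2 + k)                                                ≡⟨ binom-suc (suc m) (suc k) ⟩
  binom (1 + m) (1 + k) +ℤ binom (1 + m) (2 + k)                       ≡⟨ cong₂ _+ℤ_ (binom-suc m k) (binom-suc m (suc k)) ⟩
  (binom m k +ℤ binom m (1 + k)) +ℤ (binom m (1 + k) +ℤ binom m (2 + k)) ≡⟨ regroup (binom m k) (binom m (1 + k)) (binom m (2 + k)) ⟩
  binom m k +ℤ + 2 *ℤ binom m (1 + k) +ℤ binom m (2 + k)                ∎
  where
  regroup : ∀ x y z → (x +ℤ y) +ℤ (y +ℤ z) ≡ x +ℤ + 2 *ℤ y +ℤ z
  regroup = solve-∀

binom-symmetric : ∀ {N} k l → k + l ≡ N → binom N k ≡ binom N l
binom-symmetric k l refl = cong +_ (trans (nCk≡nC[n∸k] (ℕ.m≤m+n k l)) (cong ((k + l) C_) (ℕ.m+n∸m≡n k l)))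

row : ℕ → ℕ → ℤ
row n k = binom (2 * n) (k + n)

row-vanish : ∀ {n k} → n < k → row n k ≡ + 0
row-vanish {n} {k} n<k = cong +_ (k>n⇒nCk≡0 (ℕ.≤-<-trans (ℕ.≤-reflexive 2n≡n+n) (ℕ.+-monoˡ-< n n<k)))
  where
  2n≡n+n : 2 * n ≡ n + n
  2n≡n+n = cong (λ m → n + m) (ℕ.+-identityʳ n)

row-pascal : ∀ n k → row (suc n) k ≡ pascalStep (row n) k
row-pascal zero    zero    = refl
row-pascal (suc m) zero    = begin
  binom (2 * suc (suc m)) (2 + m)                                           ≡⟨ cong (λ N → binom N (2 + m)) (ℕ.*-suc 2 (suc m)) ⟩
  binom (2 + 2 * suc m) (2 + m)                                             ≡⟨ binom-pascal² (2 * suc m) m ⟩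
  binom (2 * suc m) m +ℤ + 2 *ℤ binom (2 * suc m) (1 + m) +ℤ binom (2 * suc m) (2 + m)
    ≡⟨ cong (λ b → b +ℤ + 2 *ℤ binom (2 * suc m) (1 + m) +ℤ binom (2 * suc m) (2 + m))
            (binom-symmetric m (2 + m) (sum≡ m)) ⟩
  pascalStep (row (suc m)) 0                                                ∎
  where
  sum≡ : ∀ m → m + (2 + m) ≡ 2 * suc m
  sum≡ = ℕ-Solver.solve-∀
row-pascal n (suc k) = trans (cong₂ binom (ℕ.*-suc 2 n) (cong suc (ℕ.+-suc k n))) (binom-pascal² (2 * n) (k + n))

pairing-row-suc : ∀ n w → pairing (suc n) (row (suc n)) w ≡ pairing n (row n) (pascalStep w)
pairing-row-suc n w = begin
  pairing (suc n) (row (suc n)) w                                         ≡⟨ pairing-cong (suc n) (row-pascal n) (λ _ → refl) ⟩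
  pairing (suc n) (pascalStep (row n)) w                                  ≡⟨ pascalStep-selfAdjoint (suc n) (row n) w (row-vanish (ℕ.n<1+n n)) (row-vanish (ℕ.m<n⇒m<1+n (ℕ.n<1+n n))) ⟩
  pairing (suc n) (row n) (pascalStep w)                                  ≡⟨ pairing-suc n (row n) (pascalStep w) ⟩
  pairing n (row n) (pascalStep w) +ℤ + 2 *ℤ (row n (suc n) *ℤ pascalStep w (suc n))
    ≡⟨ cong (λ a → pairing n (row n) (pascalStep w) +ℤ + 2 *ℤ (a *ℤ pascalStep w (suc n))) (row-vanish (ℕ.n<1+n n)) ⟩
  pairing n (row n) (pascalStep w) +ℤ + 0                                 ≡⟨ ℤ.+-identityʳ _ ⟩
  pairing n (row n) (pascalStep w)                                        ∎

pairing-row-eigen : ∀ (u v : ℕ → ℤ) → (∀ k → (pascalStep u k , pascalStep v k) ≡ (+ 2 , + 1) · (u k , v k)) →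
                    ∀ n → (pairing n (row n) u , pairing n (row n) v) ≡ pow2+√3 n · (u 0 , v 0)
pairing-row-eigen u v eigen zero    = refl
pairing-row-eigen u v eigen (suc n) = cong₂ _,_
  (begin
    pairing (suc n) (row (suc n)) u   ≡⟨ step u (+ 2) (+ 3) (λ k → trans (cong proj₁ (eigen k)) (one-* (u k) (v k))) ⟩
    + 2 *ℤ P u +ℤ + 3 *ℤ P v          ≡⟨ cong₂ (λ p q → + 2 *ℤ p +ℤ + 3 *ℤ q) (cong proj₁ IH) (cong proj₂ IH) ⟩
    + 2 *ℤ (x *ℤ u₀ +ℤ + 3 *ℤ (y *ℤ v₀)) +ℤ + 3 *ℤ (x *ℤ v₀ +ℤ y *ℤ u₀)
                                      ≡⟨ first x y u₀ v₀ ⟩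
    proj₁ (pow2+√3 (suc n) · (u₀ , v₀)) ∎)
  (begin
    pairing (suc n) (row (suc n)) v   ≡⟨ step v (+ 1) (+ 2) (λ k → trans (cong proj₂ (eigen k)) (swap-one (u k) (v k))) ⟩
    + 1 *ℤ P u +ℤ + 2 *ℤ P v          ≡⟨ cong₂ (λ p q → + 1 *ℤ p +ℤ + 2 *ℤ q) (cong proj₁ IH) (cong proj₂ IH) ⟩
    + 1 *ℤ (x *ℤ u₀ +ℤ + 3 *ℤ (y *ℤ v₀)) +ℤ + 2 *ℤ (x *ℤ v₀ +ℤ y *ℤ u₀)
                                      ≡⟨ second x y u₀ v₀ ⟩
    proj₂ (pow2+√3 (suc n) · (u₀ , v₀)) ∎)
  where
  P : (ℕ → ℤ) → ℤ
  P = pairing n (row n)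
  IH = pairing-row-eigen u v eigen n
  x = proj₁ (pow2+√3 n)
  y = proj₂ (pow2+√3 n)
  u₀ = u 0
  v₀ = v 0
  step : ∀ w a b → (∀ k → pascalStep w k ≡ a *ℤ u k +ℤ b *ℤ v k) → pairing (suc n) (row (suc n)) w ≡ a *ℤ P u +ℤ b *ℤ P v
  step w a b eq = trans (pairing-row-suc n w) (trans (pairing-cong n {α = row n} (λ _ → refl) eq) (pairing-linear n (row n) a b u v))
  one-* : ∀ p q → + 2 *ℤ p +ℤ + 3 *ℤ (+ 1 *ℤ q) ≡ + 2 *ℤ p +ℤ + 3 *ℤ q
  one-* = solve-∀
  swap-one : ∀ p q → + 2 *ℤ q +ℤ + 1 *ℤ p ≡ + 1 *ℤ p +ℤ + 2 *ℤ q
  swap-one = solve-∀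
  first : ∀ x y u₀ v₀ → + 2 *ℤ (x *ℤ u₀ +ℤ + 3 *ℤ (y *ℤ v₀)) +ℤ + 3 *ℤ (x *ℤ v₀ +ℤ y *ℤ u₀)
                      ≡ (+ 2 *ℤ x +ℤ + 3 *ℤ (+ 1 *ℤ y)) *ℤ u₀ +ℤ + 3 *ℤ ((+ 2 *ℤ y +ℤ + 1 *ℤ x) *ℤ v₀)
  first = solve-∀
  second : ∀ x y u₀ v₀ → + 1 *ℤ (x *ℤ u₀ +ℤ + 3 *ℤ (y *ℤ v₀)) +ℤ + 2 *ℤ (x *ℤ v₀ +ℤ y *ℤ u₀)
                       ≡ (+ 2 *ℤ x +ℤ + 3 *ℤ (+ 1 *ℤ y)) *ℤ v₀ +ℤ (+ 2 *ℤ y +ℤ + 1 *ℤ x) *ℤ u₀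
  second = solve-∀

twoCosPiSixth : ℕ → ℤ√3
twoCosPiSixth 0  = (+ 2 , + 0)
twoCosPiSixth 1  = (+ 0 , + 1)
twoCosPiSixth 2  = (+ 1 , + 0)
twoCosPiSixth 3  = (+ 0 , + 0)
twoCosPiSixth 4  = (- + 1 , + 0)
twoCosPiSixth 5  = (+ 0 , - + 1)
twoCosPiSixth 6  = (- + 2 , + 0)
twoCosPiSixth 7  = (+ 0 , - + 1)
twoCosPiSixth 8  = (- + 1 , + 0)
twoCosPiSixth 9  = (+ 0 , + 0)
twoCosPiSixth 10 = (+ 1 , + 0)
twoCosPiSixth 11 = (+ 0 , + 1)
twoCosPiSixth (suc (suc (suc (suc (suc (suc (suc (suc (suc (suc (suc (suc k)))))))))))) = twoCosPiSixth k

cosPart sinPart : ℕ → ℤ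
cosPart k = proj₁ (twoCosPiSixth k)
sinPart k = proj₂ (twoCosPiSixth k)

twoCosPiSixth-eigen : ∀ k → (pascalStep cosPart k , pascalStep sinPart k) ≡ (+ 2 , + 1) · twoCosPiSixth k
twoCosPiSixth-eigen 0  = refl
twoCosPiSixth-eigen 1  = refl
twoCosPiSixth-eigen 2  = refl
twoCosPiSixth-eigen 3  = refl
twoCosPiSixth-eigen 4  = refl
twoCosPiSixth-eigen 5  = refl
twoCosPiSixth-eigen 6  = refl
twoCosPiSixth-eigen 7  = refl
twoCosPiSixth-eigen 8  = refl
twoCosPiSixth-eigen 9  = refl
twoCosPiSixth-eigen 10 = refl
twoCosPiSixth-eigen 11 = refl
twoCosPiSixth-eigen 12 = refl
twoCosPiSixth-eigen (suc (suc (suc (suc (suc (suc (suc (suc (suc (suc (suc (suc (suc k))))))))))))) =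
  twoCosPiSixth-eigen (suc k)

X≡cosPartSum : ∀ n → X n ≡ binom (2 * n) n +ℤ Σ₁ n (λ k → row n k *ℤ cosPart k)
X≡cosPartSum n = ℤ.*-cancelˡ-≡ (+ 2) _ _ (begin
  + 2 *ℤ X n                                     ≡⟨ twice (X n) (proj₂ (pow2+√3 n)) ⟩
  proj₁ (pow2+√3 n · (+ 2 , + 0))                ≡⟨ cong proj₁ (pairing-row-eigen cosPart sinPart twoCosPiSixth-eigen n) ⟨
  pairing n (row n) cosPart                      ≡⟨ cong (_+ℤ + 2 *ℤ S) (ℤ.*-comm (binom (2 * n) n) (+ 2)) ⟩
  + 2 *ℤ binom (2 * n) n +ℤ + 2 *ℤ S             ≡⟨ ℤ.*-distribˡ-+ (+ 2) (binom (2 * n) n) S ⟨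
  + 2 *ℤ (binom (2 * n) n +ℤ S)                  ∎)
  where
  S = Σ₁ n (λ k → row n k *ℤ cosPart k)
  twice : ∀ x y → + 2 *ℤ x ≡ x *ℤ + 2 +ℤ + 3 *ℤ (y *ℤ + 0)
  twice = solve-∀

twoCosPiThird-periodic : ∀ j → twoCosPiThird (6 + j) ≡ twoCosPiThird j
twoCosPiThird-periodic j = cong twoCosPiThirdTable (trans (cong (_% 6) (ℕ.+-comm 6 j)) ([m+n]%n≡m%n j 6))

cosPart-even : ∀ j → cosPart (j * 2) ≡ twoCosPiThird j
cosPart-even 0 = refl
cosPart-even 1 = refl
cosPart-even 2 = refl
cosPart-even 3 = refl
cosPart-even 4 = refl
cosPart-even 5 = refl
cosPart-even (suc (suc (suc (suc (suc (suc j)))))) = trans (cosPart-even j) (sym (twoCosPiThird-periodic j))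

cosPart-odd : ∀ j → cosPart (j * 2 + 1) ≡ + 0
cosPart-odd 0 = refl
cosPart-odd 1 = refl
cosPart-odd 2 = refl
cosPart-odd 3 = refl
cosPart-odd 4 = refl
cosPart-odd 5 = refl
cosPart-odd (suc (suc (suc (suc (suc (suc j)))))) = cosPart-odd j

X≡cosineSum : ∀ n → X n ≡ binom (2 * n) n +ℤ Σ₁ n (λ j → binom (2 * n) (n + 2 * j) *ℤ twoCosPiThird j)
X≡cosineSum n = trans (X≡cosPartSum n) (cong (binom (2 * n) n +ℤ_) (begin
  Σ₁ n F                      ≡⟨ Σ₁-truncate F (ℕ.m≤m*n n 2) (λ k n<k → cong (_*ℤ cosPart k) (row-vanish n<k)) ⟨
  Σ₁ (n * 2) F                ≡⟨ Σ₁-multiples 1 n F odd-zero ⟩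
  Σ₁ n (λ j → F (j * 2))      ≡⟨ Σ₁-cong n (λ j → cong₂ _*ℤ_ (cong (binom (2 * n)) (index j)) (cosPart-even j)) ⟩
  Σ₁ n (λ j → binom (2 * n) (n + 2 * j) *ℤ twoCosPiThird j) ∎))
  where
  F : ℕ → ℤ
  F k = row n k *ℤ cosPart k
  odd-zero : ∀ j i → i < 1 → F (j * 2 + suc i) ≡ + 0
  odd-zero j zero _ = trans (cong (row n (j * 2 + 1) *ℤ_) (cosPart-odd j)) (ℤ.*-zeroʳ (row n (j * 2 + 1)))
  odd-zero j (suc i) (s≤s ())
  index : ∀ j → j * 2 + n ≡ n + 2 * j
  index j = trans (ℕ.+-comm (j * 2) n) (cong (λ m → n + m) (ℕ.*-comm j 2))

sgn₃ : ℕ → ℤ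
sgn₃ 0 = + 1
sgn₃ 1 = + 0
sgn₃ 2 = + 0
sgn₃ (suc (suc (suc j))) = - sgn₃ j

sgn₃-multiple : ∀ j → sgn₃ (j * 3) ≡ sgn j
sgn₃-multiple zero    = refl
sgn₃-multiple (suc j) = cong -_ (sgn₃-multiple j)

sgn₃-nonMultiple : ∀ j i → i < 2 → sgn₃ (j * 3 + suc i) ≡ + 0
sgn₃-nonMultiple zero    0 _ = refl
sgn₃-nonMultiple zero    1 _ = refl
sgn₃-nonMultiple zero    (suc (suc i)) (s≤s (s≤s ()))
sgn₃-nonMultiple (suc j) i i<2 = cong -_ (sgn₃-nonMultiple j i i<2)

twoCosPiThird≡sgn₃ : ∀ j → twoCosPiThird j ≡ - sgn j +ℤ + 3 *ℤ sgn₃ j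
twoCosPiThird≡sgn₃ 0 = refl
twoCosPiThird≡sgn₃ 1 = refl
twoCosPiThird≡sgn₃ 2 = refl
twoCosPiThird≡sgn₃ 3 = refl
twoCosPiThird≡sgn₃ 4 = refl
twoCosPiThird≡sgn₃ 5 = refl
twoCosPiThird≡sgn₃ (suc (suc (suc (suc (suc (suc j)))))) = begin
  twoCosPiThird (6 + j)                    ≡⟨ twoCosPiThird-periodic j ⟩
  twoCosPiThird j                          ≡⟨ twoCosPiThird≡sgn₃ j ⟩
  - sgn j +ℤ + 3 *ℤ sgn₃ j                 ≡⟨ cong₂ (λ s t → - s +ℤ + 3 *ℤ t) (sym (neg⁶ (sgn j))) (sym (ℤ.neg-involutive (sgn₃ j))) ⟩
  - sgn (6 + j) +ℤ + 3 *ℤ sgn₃ (6 + j)     ∎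
  where
  neg⁶ : ∀ x → - - - - - - x ≡ x
  neg⁶ x = trans (ℤ.neg-involutive _) (trans (ℤ.neg-involutive _) (ℤ.neg-involutive x))

X≡alternatingSums : ∀ n → X n ≡ (binom (2 * n) n -ℤ Σ₁ n (λ j → sgn j *ℤ binom (2 * n) (n + 2 * j)))
                               +ℤ (+ 3) *ℤ Σ₁ n (λ j → sgn j *ℤ binom (2 * n) (n + 6 * j))
X≡alternatingSums n = begin
  X n                                                            ≡⟨ X≡cosineSum n ⟩
  binom (2 * n) n +ℤ Σ₁ n (λ j → A j *ℤ twoCosPiThird j)         ≡⟨ cong (binom (2 * n) n +ℤ_) split ⟩
  binom (2 * n) n +ℤ (- + 1 *ℤ Σ₁ n (λ j → sgn j *ℤ A j) +ℤ + 3 *ℤ Σ₁ n G)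
                                                                 ≡⟨ cong (λ t → binom (2 * n) n +ℤ (- + 1 *ℤ Σ₁ n (λ j → sgn j *ℤ A j) +ℤ + 3 *ℤ t)) Σ₁G ⟩
  binom (2 * n) n +ℤ (- + 1 *ℤ Σ₁ n (λ j → sgn j *ℤ A j) +ℤ + 3 *ℤ Σ₁ n (λ j → sgn j *ℤ binom (2 * n) (n + 6 * j)))
                                                                 ≡⟨ regroup (binom (2 * n) n) (Σ₁ n (λ j → sgn j *ℤ A j)) _ ⟩
  (binom (2 * n) n -ℤ Σ₁ n (λ j → sgn j *ℤ A j)) +ℤ + 3 *ℤ Σ₁ n (λ j → sgn j *ℤ binom (2 * n) (n + 6 * j)) ∎
  where
  A G : ℕ → ℤ
  A j = binom (2 * n) (n + 2 * j)
  G j = A j *ℤ sgn₃ j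
  split : Σ₁ n (λ j → A j *ℤ twoCosPiThird j) ≡ - + 1 *ℤ Σ₁ n (λ j → sgn j *ℤ A j) +ℤ + 3 *ℤ Σ₁ n G
  split = trans (Σ₁-cong n (λ j → trans (cong (A j *ℤ_) (twoCosPiThird≡sgn₃ j)) (distrib (A j) (sgn j) (sgn₃ j))))
                (Σ₁-linear n (- + 1) (+ 3) _ G)
    where
    distrib : ∀ a s t → a *ℤ (- s +ℤ + 3 *ℤ t) ≡ - + 1 *ℤ (s *ℤ a) +ℤ + 3 *ℤ (a *ℤ t)
    distrib = solve-∀
  A-vanish : ∀ {k} → n < k → A k ≡ + 0
  A-vanish {k} n<k = cong +_ (k>n⇒nCk≡0 (ℕ.≤-<-trans (ℕ.≤-reflexive (cong (λ m → n + m) (ℕ.+-identityʳ n)))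
                                                    (ℕ.+-monoʳ-< n (ℕ.<-≤-trans n<k (ℕ.m≤n*m k 2)))))
  Σ₁G : Σ₁ n G ≡ Σ₁ n (λ j → sgn j *ℤ binom (2 * n) (n + 6 * j))
  Σ₁G = begin
    Σ₁ n G                    ≡⟨ Σ₁-truncate G (ℕ.m≤m*n n 3) (λ k n<k → cong (_*ℤ sgn₃ k) (A-vanish n<k)) ⟨
    Σ₁ (n * 3) G              ≡⟨ Σ₁-multiples 2 n G (λ j i i<2 → trans (cong (A (j * 3 + suc i) *ℤ_) (sgn₃-nonMultiple j i i<2)) (ℤ.*-zeroʳ (A (j * 3 + suc i)))) ⟩
    Σ₁ n (λ j → G (j * 3))    ≡⟨ Σ₁-cong n (λ j → trans (cong₂ _*ℤ_ (cong (λ m → binom (2 * n) (n + m)) (index j)) (sgn₃-multiple j))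
                                                        (ℤ.*-comm _ (sgn j))) ⟩
    Σ₁ n (λ j → sgn j *ℤ binom (2 * n) (n + 6 * j)) ∎
    where
    index : ∀ j → 2 * (j * 3) ≡ 6 * j
    index = ℕ-Solver.solve-∀
  regroup : ∀ b s t → b +ℤ (- + 1 *ℤ s +ℤ + 3 *ℤ t) ≡ (b -ℤ s) +ℤ + 3 *ℤ t
  regroup = solve-∀

mainTheorem3 : (n : ℕ) →
    (X n ≡ (binom (2 * n) n -ℤ Σ₁ n (λ j → sgn j *ℤ binom (2 * n) (n + 2 * j)))
             +ℤ (+ 3) *ℤ Σ₁ n (λ j → sgn j *ℤ binom (2 * n) (n + 6 * j)))
    × (X n ≡ binom (2 * n) n +ℤ Σ₁ n (λ j → binom (2 * n) (n + 2 * j) *ℤ twoCosPiThird j))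
mainTheorem3 n = X≡alternatingSums n , X≡cosineSum n
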